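{- Let $n\ge 3$ be an integer and let $\mathcal{F}=\{R,G,B,Y\}$ be a 1-factorisation of $Circ(2n,\{1,3\})$. If $\mathcal{F}$ has 4 sequential gaps between vertices $v$ and $v+4$ in the order $R,G,B,Y$, then $\{v,v+3\}\in Y$ and $\{v+1,v+4\}\in R$.
   Context: For a positive integer $N$ and $D\subseteq\{1,\dots,\lfloor N/2\rfloor\}$, the circulant graph $Circ(N,D)$ has vertex set $\mathbb{Z}_N$, with $u,v$ adjacent iff $u-v\equiv \pm d \pmod N$ for some $d\in D$. A 1-factor is a 1-regular spanning subgraph (identified with its edge set); a 1-factorisation is a partition of the edge set into 1-factors. All vertex arithmetic is modulo $2n$. A 1-factor $F$ of $Circ(2n,\{1,3\})$ has a gap at vertices $(v,v+1)$ if $F$ contains none of the edges $\{v,v+1\},\{v-2,v+1\},\{v,v+3\},\{v-1,v+2\}$. The 1-factorisation has $z$ sequential gaps between vertices $v$ and $v+z$ in the order $F_1,\dots,F_z$ if $F_1,\dots,F_z$ are 1-factors of it having gaps at $(v,v+1),(v+1,v+2),\dots,(v+z-1,v+z)$ respectively. -}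

module Defs where

open import Data.Nat using (ℕ; zero; suc; _+_; _*_; _∸_; _≤_)
open import Data.Nat.DivMod using (_mod_)
open import Data.Fin using (Fin; toℕ)
open import Data.Product using (_×_; ∃)
open import Data.Sum using (_⊎_)
open import Relation.Nullary using (¬_)
open import Relation.Binary.PropositionalEquality using (_≡_)

_⊕_ : {N : ℕ} → Fin N → ℕ → Fin N
_⊕_ {suc N} v k = (toℕ v + k) mod (suc N)

-- v ⊖ k = v - k (mod N), for k ≤ N
_⊖_ : {N : ℕ} → Fin N → ℕ → Fin N
_⊖_ {N} v k = v ⊕ (N ∸ k)

infixl 6 _⊕_ _⊖_

CircAdj13 : {N : ℕ} → Fin N → Fin N → Set
CircAdj13 u v = (v ≡ u ⊕ 1) ⊎ (u ≡ v ⊕ 1) ⊎ (v ≡ u ⊕ 3) ⊎ (u ≡ v ⊕ 3)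

-- An edge set of a graph on Fin N is a symmetric relation
-- (E u v means the edge {u,v} belongs to the set).
EdgeSet : ℕ → Set₁
EdgeSet N = Fin N → Fin N → Set

IsOneFactor : {N : ℕ} → EdgeSet N → Set
IsOneFactor {N} E =
  (∀ u v → E u v → E v u) ×
  (∀ u v → E u v → CircAdj13 u v) ×
  (∀ v → ∃ λ u → E v u × (∀ w → E v w → w ≡ u))

IsOneFactorisation4 : {N : ℕ} → (Fin 4 → EdgeSet N) → Set
IsOneFactorisation4 {N} F =
  (∀ i → IsOneFactor (F i)) ×
  (∀ (u v : Fin N) → CircAdj13 u v → ∃ λ i → F i u v) ×
  (∀ i j (u v : Fin N) → F i u v → F j u v → i ≡ j)

HasGap : {N : ℕ} → EdgeSet N → Fin N → Set
HasGap E v =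
  ¬ E v (v ⊕ 1) × ¬ E (v ⊖ 2) (v ⊕ 1) × ¬ E v (v ⊕ 3) × ¬ E (v ⊖ 1) (v ⊕ 2)

FourSequentialGaps : {N : ℕ} → EdgeSet N → EdgeSet N → EdgeSet N → EdgeSet N
                   → Fin N → Set
FourSequentialGaps F₁ F₂ F₃ F₄ v =
  HasGap F₁ v × HasGap F₂ (v ⊕ 1) × HasGap F₃ (v ⊕ 2) × HasGap F₄ (v ⊕ 3)

-- The four edges a gap at (w,w+1) forbids include the three chords {u,u+3}
-- passing over it (u = w, w-1, w-2).  So the gaps of R, G, B at v, v+1,
-- v+2 exclude {v,v+3} from R, G, B, and the gaps of G, B, Y at v+1, v+2, v+3
-- exclude {v+1,v+4} from G, B, Y; as the four factors cover every edge, the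
-- remaining factor must contain it.
module Submission where

open import Defs
open import Data.Nat using (ℕ; zero; suc; _+_; _*_; _∸_; _≤_; _%_; s≤s; z≤n; NonZero)
open import Data.Nat.DivMod using (%-distribˡ-+; m%n%n≡m%n; [m+n]%n≡m%n; m<n⇒m%n≡m; m%n<n)
open import Data.Nat.Properties using (+-assoc; m+[n∸m]≡n; *-monoʳ-≤)
open import Data.Fin using (Fin; zero; suc; toℕ)
open import Data.Fin.Properties using (toℕ-injective; toℕ-fromℕ<; toℕ<n)
open import Data.Product using (_×_; _,_; ∃)
open import Data.Sum using (inj₁; inj₂)
open import Data.Empty using (⊥-elim)
open import Relation.Nullary using (¬_)
open import Relation.Binary.PropositionalEquality

[m%n+k]%n≡[m+k]%n : ∀ m k n .{{_ : NonZero n}} → (m % n + k) % n ≡ (m + k) % n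
[m%n+k]%n≡[m+k]%n m k n = begin
  (m % n + k) % n           ≡⟨ %-distribˡ-+ (m % n) k n ⟩
  (m % n % n + k % n) % n   ≡⟨ cong (λ t → (t + k % n) % n) (m%n%n≡m%n m n) ⟩
  (m % n + k % n) % n       ≡⟨ %-distribˡ-+ m k n ⟨
  (m + k) % n               ∎
  where open ≡-Reasoning

module _ {M : ℕ} where

  toℕ-⊕ : (v : Fin (suc M)) (k : ℕ) → toℕ (v ⊕ k) ≡ (toℕ v + k) % suc M
  toℕ-⊕ v k = toℕ-fromℕ< (m%n<n (toℕ v + k) (suc M))

  ⊕-assoc : (v : Fin (suc M)) (a b : ℕ) → (v ⊕ a) ⊕ b ≡ v ⊕ (a + b)
  ⊕-assoc v a b = toℕ-injective (begin
    toℕ ((v ⊕ a) ⊕ b)                 ≡⟨ toℕ-⊕ (v ⊕ a) b ⟩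
    (toℕ (v ⊕ a) + b) % suc M         ≡⟨ cong (λ t → (t + b) % suc M) (toℕ-⊕ v a) ⟩
    ((toℕ v + a) % suc M + b) % suc M ≡⟨ [m%n+k]%n≡[m+k]%n (toℕ v + a) b (suc M) ⟩
    (toℕ v + a + b) % suc M           ≡⟨ cong (_% suc M) (+-assoc (toℕ v) a b) ⟩
    (toℕ v + (a + b)) % suc M         ≡⟨ toℕ-⊕ v (a + b) ⟨
    toℕ (v ⊕ (a + b))                 ∎)
    where open ≡-Reasoning

  ⊕-period : (v : Fin (suc M)) → v ⊕ suc M ≡ v
  ⊕-period v = toℕ-injective (begin
    toℕ (v ⊕ suc M)           ≡⟨ toℕ-⊕ v (suc M) ⟩
    (toℕ v + suc M) % suc M   ≡⟨ [m+n]%n≡m%n (toℕ v) (suc M) ⟩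
    toℕ v % suc M             ≡⟨ m<n⇒m%n≡m (toℕ<n v) ⟩
    toℕ v                     ∎)
    where open ≡-Reasoning

  ⊕-⊖-cancel : (v : Fin (suc M)) {k : ℕ} → k ≤ suc M → (v ⊕ k) ⊖ k ≡ v
  ⊕-⊖-cancel v {k} k≤N = begin
    (v ⊕ k) ⊕ (suc M ∸ k)   ≡⟨ ⊕-assoc v k (suc M ∸ k) ⟩
    v ⊕ (k + (suc M ∸ k))   ≡⟨ cong (v ⊕_) (m+[n∸m]≡n k≤N) ⟩
    v ⊕ suc M               ≡⟨ ⊕-period v ⟩
    v                       ∎
    where open ≡-Reasoning

  module _ (E : EdgeSet (suc M)) (u : Fin (suc M)) where

    gap₊₁⇒¬chord : HasGap E (u ⊕ 1) → ¬ E u (u ⊕ 3)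
    gap₊₁⇒¬chord (_ , _ , _ , ¬E[w-1,w+2]) e =
      ¬E[w-1,w+2] (subst₂ E (sym (⊕-⊖-cancel u (s≤s z≤n))) (sym (⊕-assoc u 1 2)) e)

    gap₊₂⇒¬chord : 2 ≤ suc M → HasGap E (u ⊕ 2) → ¬ E u (u ⊕ 3)
    gap₊₂⇒¬chord 2≤N (_ , ¬E[w-2,w+1] , _ , _) e =
      ¬E[w-2,w+1] (subst₂ E (sym (⊕-⊖-cancel u 2≤N)) (sym (⊕-assoc u 2 1)) e)

sole-candidate : {N : ℕ} {I : Set} (F : I → EdgeSet N) →
  (∀ u w → CircAdj13 u w → ∃ λ i → F i u w) →
  ∀ {u w j} → CircAdj13 u w → (∀ i → F i u w → i ≡ j) → F j u w
sole-candidate F cover {u} {w} adj only with cover u w adj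
... | i , e = subst (λ k → F k u w) (only i e) e

chord : {N : ℕ} (u : Fin N) → CircAdj13 u (u ⊕ 3)
chord u = inj₂ (inj₂ (inj₁ refl))

mainTheorem12 : (n : ℕ) → 3 ≤ n →
    (F : Fin 4 → EdgeSet (2 * n)) → IsOneFactorisation4 F →
    (v : Fin (2 * n)) →
    FourSequentialGaps (F zero) (F (suc zero)) (F (suc (suc zero))) (F (suc (suc (suc zero)))) v →
    F (suc (suc (suc zero))) v (v ⊕ 3) × F zero (v ⊕ 1) (v ⊕ 4)
mainTheorem12 (suc m) (s≤s _) F (_ , cover , _) v
  ((_ , _ , ¬R[v,v+3] , _) , gapG@(_ , _ , ¬G[v+1,v+4] , _) , gapB , gapY) =
  vChordInY , subst (F zero (v ⊕ 1)) (⊕-assoc v 1 3) v+1ChordInR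
  where
  G B Y : EdgeSet (2 * suc m)
  G = F (suc zero)
  B = F (suc (suc zero))
  Y = F (suc (suc (suc zero)))

  2≤N : 2 ≤ 2 * suc m
  2≤N = *-monoʳ-≤ 2 (s≤s z≤n)

  vChordInY : Y v (v ⊕ 3)
  vChordInY = sole-candidate F cover (chord v) λ where
    zero                   e → ⊥-elim (¬R[v,v+3] e)
    (suc zero)             e → ⊥-elim (gap₊₁⇒¬chord G v gapG e)
    (suc (suc zero))       e → ⊥-elim (gap₊₂⇒¬chord B v 2≤N gapB e)
    (suc (suc (suc zero))) _ → refl

  v+1ChordInR : F zero (v ⊕ 1) ((v ⊕ 1) ⊕ 3)
  v+1ChordInR = sole-candidate F cover (chord (v ⊕ 1)) λ where
    zero                   _ → refl
    (suc zero)             e → ⊥-elim (¬G[v+1,v+4] e)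
    (suc (suc zero))       e → ⊥-elim (gap₊₁⇒¬chord B (v ⊕ 1)
                                  (subst (HasGap B) (sym (⊕-assoc v 1 1)) gapB) e)
    (suc (suc (suc zero))) e → ⊥-elim (gap₊₂⇒¬chord Y (v ⊕ 1) 2≤N
                                  (subst (HasGap Y) (sym (⊕-assoc v 1 2)) gapY) e)
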